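{- In the setting below, for any $\epsilon\in(0,1/3)$, $\mathrm{Area}(\mathcal R_T\setminus\mathcal H)\le 9\epsilon\,\mathrm{Area}(\mathcal H)$.
   Context: Setting: discrete-time FIFO queue over $[0,T]$ with arbitrary arrivals and departures; every packet waits at least one time unit; $h_t$ is the queue height at integer time $t$. For packet $i$ present at time $t$, $w_{it}=t-a_i$ is its waiting time and $h_{it}$ its height (number of packets ahead including itself). Height diagram: $\mathcal H$ is the set of points $(t',y)$ with $t'\in(t-1,t]$ and $y\le h_t$. Packets ping randomly over time (any realization); whenever packet $i$ pings at time $t$, the server creates the rectangle $[t,t+3\epsilon w_{it}]\times[0,(1+3\epsilon)h_{it}]$, and $\mathcal R_T$ is the union of all rectangles created up to time $T$. $\mathrm{Area}$ denotes two-dimensional area.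
   Formalization: The parameter ε ranges over the rationals in the interval (0,1/3). -}

module Defs where

open import Data.Nat as ℕ using (ℕ; zero; suc; _≤?_; _<?_)
open import Data.Integer using (+_)
open import Data.Rational as ℚ using (ℚ; 0ℚ; _+_; _-_; _*_; _⊔_; _⊓_; _/_)
open import Data.Fin using (Fin; toℕ)
open import Data.List using (List; []; _∷_; _++_; map; length; upTo; concatMap)
open import Data.Nat.ListAction using (sum)
open import Data.List.Base using (allFin)
open import Data.Vec as Vec using (Vec; []; _∷_)
open import Data.Product using (_×_; _,_; proj₁; proj₂)
open import Relation.Nullary using (does)
open import Relation.Nullary.Decidable using (_×-dec_)
open import Data.Bool using (Bool; if_then_else_)

ι : ℕ → ℚ
ι n = + n / 1

record Rect : Set where
  constructor rect
  field
    x₀ x₁ y₀ y₁ : ℚ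

rectArea : Rect → ℚ
rectArea (rect a b c d) = (0ℚ ⊔ (b - a)) * (0ℚ ⊔ (d - c))

_∩ʳ_ : Rect → Rect → Rect
rect a b c d ∩ʳ rect a' b' c' d' = rect (a ⊔ a') (b ⊓ b') (c ⊔ c') (d ⊓ d')

-- Area of a union of n rectangles, by inclusion–exclusion:
-- Area(r ∪ U) = Area(r) + Area(U) - Area(r ∩ U),  r ∩ U = ⋃ (r ∩ rₖ).
unionAreaV : (n : ℕ) → Vec Rect n → ℚ
unionAreaV zero [] = 0ℚ
unionAreaV (suc n) (r ∷ rs) =
  rectArea r + unionAreaV n rs - unionAreaV n (Vec.map (r ∩ʳ_) rs)

-- A region is a finite union of rectangles, given as a list.
Region : Set
Region = List Rect

Area : Region → ℚ
Area rs = unionAreaV (length rs) (Vec.fromList rs)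

-- Area(A ∖ B) = Area(A ∪ B) - Area(B)
AreaDiff : Region → Region → ℚ
AreaDiff A B = Area (A ++ B) - Area B

-- The FIFO queue.  Packets are indexed by Fin n in FIFO order;
-- packet i arrives at aᵢ and departs at dᵢ (integer times), and is
-- present at integer time t iff aᵢ ≤ t < dᵢ.

record Queue (n : ℕ) : Set where
  field
    arr dep : Fin n → ℕ
    waits   : ∀ i → arr i ℕ.< dep i
    fifoArr : ∀ i j → toℕ i ℕ.≤ toℕ j → arr i ℕ.≤ arr j
    fifoDep : ∀ i j → toℕ i ℕ.≤ toℕ j → dep i ℕ.≤ dep j

module _ {n : ℕ} (Q : Queue n) where
  open Queue Q

  present? : Fin n → ℕ → Bool
  present? i t = does ((arr i ≤? t) ×-dec (t <? dep i))

  Present : Fin n → ℕ → Set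
  Present i t = arr i ℕ.≤ t × t ℕ.< dep i

  count : (Fin n → Bool) → ℕ
  count p = sum (map (λ j → if p j then 1 else 0) (allFin n))

  height : ℕ → ℕ
  height t = count (λ j → present? j t)

  heightOf : Fin n → ℕ → ℕ
  heightOf i t = count (λ j → does (toℕ j ≤? toℕ i) Data.Bool.∧ present? j t)

  waitOf : Fin n → ℕ → ℕ
  waitOf i t = t ℕ.∸ arr i

  -- Height diagram 𝓗 over [0,T]: columns (t-1,t] × [0,h_t], t = 0..T
  -- (half-openness is irrelevant for area).
  heightDiagram : ℕ → Region
  heightDiagram T =
    map (λ t → rect (ι t - ι 1) (ι t) 0ℚ (ι (height t))) (upTo (suc T))

  pingRect : ℚ → Fin n × ℕ → Rect
  pingRect ε (i , t) =
    rect (ι t) (ι t + ι 3 * ε * ι (waitOf i t))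
         0ℚ ((ι 1 + ι 3 * ε) * ι (heightOf i t))

  pingRegion : ℚ → List (Fin n × ℕ) → Region
  pingRegion ε pings = map (pingRect ε) pings

{-# OPTIONS --safe #-}
module Submission where

-- Write ε = p/Q and cut the time axis into cells of width 1/Q. Every rectangle involved has its
-- vertical sides on this grid, so the area of a union of them is 1/Q times the sum, over cells, of
-- the height of the highest rectangle above the cell. Slice the height diagram into horizontal
-- levels: at level ℓ it is a union of runs of consecutive times with height > ℓ. When packet i
-- pings at time t with height h, every packet ahead of it has been present since its arrival a
-- (FIFO), so each level below h has been occupied throughout [a, t]; hence the ping rectangle
-- extends each of these levels past t by at most 3ε times the length of the current run. Charging
-- these extensions to the ends of the runs, the part of level ℓ covered by pings but not by the
-- diagram has area at most 3ε times the area of level ℓ. The vertical stretch by 1 + 3ε costs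
-- 3ε·Area(H) more, so Area(R ∖ H) ≤ 3ε·Area(H) + (1 + 3ε)·3ε·Area(H) ≤ 9ε·Area(H) as 3ε ≤ 1.


open import Algebra.Bundles using (Semiring)
open import Data.Nat as ℕ using (ℕ; zero; suc)
import Data.Nat.Properties as ℕP
open import Data.Rational as ℚ using (ℚ)
import Data.Rational.Properties as ℚP

module RangeSum {c ℓ} (R : Semiring c ℓ) where
  open Semiring R
  import Relation.Binary.PropositionalEquality as ≡
  open import Algebra.Properties.CommutativeSemigroup +-commutativeSemigroup using (interchange)

  ∑< : ℕ → (ℕ → Carrier) → Carrier
  ∑< zero    f = 0#
  ∑< (suc m) f = ∑< m f + f m

  ∑<-cong : ∀ m {f h : ℕ → Carrier} → (∀ K → K ℕ.< m → f K ≈ h K) → ∑< m f ≈ ∑< m h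
  ∑<-cong zero    f≈h = refl
  ∑<-cong (suc m) f≈h = +-cong (∑<-cong m (λ K K<m → f≈h K (ℕP.m≤n⇒m≤1+n K<m))) (f≈h m ℕP.≤-refl)

  ∑<-zero : ∀ m → ∑< m (λ _ → 0#) ≈ 0#
  ∑<-zero zero    = refl
  ∑<-zero (suc m) = trans (+-identityʳ _) (∑<-zero m)

  ∑<-distrib-+ : ∀ m (f h : ℕ → Carrier) → ∑< m (λ K → f K + h K) ≈ ∑< m f + ∑< m h
  ∑<-distrib-+ zero    f h = sym (+-identityʳ 0#)
  ∑<-distrib-+ (suc m) f h = trans (+-congʳ (∑<-distrib-+ m f h)) (interchange _ _ _ _)

  ∑<-comm : ∀ m n (f : ℕ → ℕ → Carrier) →
            ∑< m (λ K → ∑< n (λ ℓ → f ℓ K)) ≈ ∑< n (λ ℓ → ∑< m (f ℓ))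
  ∑<-comm zero    n f = sym (∑<-zero n)
  ∑<-comm (suc m) n f =
    trans (+-congʳ (∑<-comm m n f)) (sym (∑<-distrib-+ n (λ ℓ → ∑< m (f ℓ)) (λ ℓ → f ℓ m)))

  ∑<-split : ∀ m k (f : ℕ → Carrier) → ∑< (m ℕ.+ k) f ≈ ∑< m f + ∑< k (λ j → f (m ℕ.+ j))
  ∑<-split m zero    f = trans (reflexive (≡.cong (λ i → ∑< i f) (ℕP.+-identityʳ m))) (sym (+-identityʳ _))
  ∑<-split m (suc k) f = trans (reflexive (≡.cong (λ i → ∑< i f) (ℕP.+-suc m k)))
                           (trans (+-congʳ (∑<-split m k f)) (+-assoc _ _ _))

  *-distribˡ-∑< : ∀ m x (f : ℕ → Carrier) → x * ∑< m f ≈ ∑< m (λ K → x * f K)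
  *-distribˡ-∑< zero    x f = zeroʳ x
  *-distribˡ-∑< (suc m) x f = trans (distribˡ x (∑< m f) (f m)) (+-congʳ (*-distribˡ-∑< m x f))

module ℕSum where
  open RangeSum ℕP.+-*-semiring public
  open import Relation.Binary.PropositionalEquality
  open import Data.Nat.DivMod using (_/_; +-distrib-/-∣ˡ; m*n/n≡m; m<n⇒m/n≡0)
  open import Data.Nat.Divisibility using (divides-refl)

  ∑<-mono-≤ : ∀ m {f h : ℕ → ℕ} → (∀ K → f K ℕ.≤ h K) → ∑< m f ℕ.≤ ∑< m h
  ∑<-mono-≤ zero    f≤h = ℕP.≤-refl
  ∑<-mono-≤ (suc m) f≤h = ℕP.+-mono-≤ (∑<-mono-≤ m f≤h) (f≤h m)

  ∑<-const : ∀ m x → ∑< m (λ _ → x) ≡ m ℕ.* x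
  ∑<-const zero    x = refl
  ∑<-const (suc m) x = trans (cong (ℕ._+ x) (∑<-const m x)) (ℕP.+-comm (m ℕ.* x) x)

  ∑<-blocks : ∀ Q .{{_ : ℕ.NonZero Q}} s (f : ℕ → ℕ) → ∑< (s ℕ.* Q) (λ K → f (K / Q)) ≡ Q ℕ.* ∑< s f
  ∑<-blocks Q zero    f = sym (ℕP.*-zeroʳ Q)
  ∑<-blocks Q (suc s) f = begin
    ∑< (Q ℕ.+ s ℕ.* Q) g                                      ≡⟨ cong (λ i → ∑< i g) (ℕP.+-comm Q (s ℕ.* Q)) ⟩
    ∑< (s ℕ.* Q ℕ.+ Q) g                                      ≡⟨ ∑<-split (s ℕ.* Q) Q g ⟩
    ∑< (s ℕ.* Q) g ℕ.+ ∑< Q (λ j → f ((s ℕ.* Q ℕ.+ j) / Q))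
      ≡⟨ cong₂ ℕ._+_ (∑<-blocks Q s f) (∑<-cong Q (λ j j<Q → cong f (block j<Q))) ⟩
    Q ℕ.* ∑< s f ℕ.+ ∑< Q (λ _ → f s)                          ≡⟨ cong (Q ℕ.* ∑< s f ℕ.+_) (∑<-const Q (f s)) ⟩
    Q ℕ.* ∑< s f ℕ.+ Q ℕ.* f s                                 ≡⟨ ℕP.*-distribˡ-+ Q (∑< s f) (f s) ⟨
    Q ℕ.* ∑< (suc s) f                                         ∎
    where
    open ≡-Reasoning
    g : ℕ → ℕ
    g K = f (K / Q)
    block : ∀ {j} → j ℕ.< Q → (s ℕ.* Q ℕ.+ j) / Q ≡ s
    block {j} j<Q = begin
      (s ℕ.* Q ℕ.+ j) / Q       ≡⟨ +-distrib-/-∣ˡ j (divides-refl s) ⟩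
      s ℕ.* Q / Q ℕ.+ j / Q     ≡⟨ cong₂ ℕ._+_ (m*n/n≡m s Q) (m<n⇒m/n≡0 j<Q) ⟩
      s ℕ.+ 0                   ≡⟨ ℕP.+-identityʳ s ⟩
      s                         ∎

open import Relation.Binary.PropositionalEquality
open import Data.Bool using (Bool; true; false; T; not; _∧_; _∨_; if_then_else_)
open import Data.Bool.Properties using (T-∧; T-∨; ∧-identityʳ; ∧-zeroʳ)
open import Data.Product using (_×_; _,_; proj₁; proj₂; ∃-syntax)
open import Data.Sum using (inj₁; inj₂; [_,_]′)
open import Data.Unit using (tt)
open import Data.Empty using (⊥-elim)
open import Function.Bundles using (Equivalence)
open import Relation.Nullary using (¬_; yes; no; Reflects; ofʸ; ofⁿ)
open import Defs

if-true : ∀ {A : Set} {b} {x y : A} → T b → (if b then x else y) ≡ x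
if-true {b = true} _ = refl

T-not⇒¬T : ∀ {b} → T (not b) → ¬ T b
T-not⇒¬T {false} _ ()

T-ext : ∀ {a b} → (T a → T b) → (T b → T a) → a ≡ b
T-ext {false} {false} _   _   = refl
T-ext {false} {true}  _   b⇒a = ⊥-elim (b⇒a tt)
T-ext {true}  {false} a⇒b _   = ⊥-elim (a⇒b tt)
T-ext {true}  {true}  _   _   = refl

module Embedding where
  open import Data.Integer as ℤ using (ℤ; +_)
  import Data.Integer.Properties as ℤP
  open import Data.Rational using (mkℚ; 0ℚ; 1ℚ; _+_; _*_; _≤_; _/_; *≤*)
  open import Data.Rational.Properties using (normalize-coprime; fromℚᵘ-cong; drop-*≤*)
  import Data.Rational.Unnormalised as ℚᵘ
  import Data.Nat.Coprimality as Coprime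

  private
    /-cong-cross : ∀ (a b : ℤ) (k l : ℕ) → a ℤ.* + suc l ≡ b ℤ.* + suc k → a / suc k ≡ b / suc l
    /-cong-cross a b k l eq = fromℚᵘ-cong {ℚᵘ.mkℚᵘ a k} {ℚᵘ.mkℚᵘ b l} (ℚᵘ.*≡* eq)

    ι≡mkℚ : ∀ n → ι n ≡ mkℚ (+ n) 0 (Coprime.sym (Coprime.1-coprimeTo n))
    ι≡mkℚ n = normalize-coprime (Coprime.sym (Coprime.1-coprimeTo n))

  ι-homo-+ : ∀ m n → ι (m ℕ.+ n) ≡ ι m + ι n
  ι-homo-+ m n rewrite ι≡mkℚ m | ι≡mkℚ n =
    /-cong-cross (+ (m ℕ.+ n)) (+ m ℤ.* + 1 ℤ.+ + n ℤ.* + 1) 0 0 (begin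
    + (m ℕ.+ n) ℤ.* + 1                       ≡⟨ ℤP.*-identityʳ _ ⟩
    + m ℤ.+ + n                               ≡⟨ cong₂ ℤ._+_ (ℤP.*-identityʳ (+ m)) (ℤP.*-identityʳ (+ n)) ⟨
    + m ℤ.* + 1 ℤ.+ + n ℤ.* + 1               ≡⟨ ℤP.*-identityʳ _ ⟨
    (+ m ℤ.* + 1 ℤ.+ + n ℤ.* + 1) ℤ.* + 1     ∎)
    where open ≡-Reasoning

  ι-homo-* : ∀ m n → ι (m ℕ.* n) ≡ ι m * ι n
  ι-homo-* m n rewrite ι≡mkℚ m | ι≡mkℚ n =
    /-cong-cross (+ (m ℕ.* n)) (+ m ℤ.* + n) 0 0 (cong (ℤ._* + 1) (ℤP.pos-* m n))

  ι-mono-≤ : ∀ {m n} → m ℕ.≤ n → ι m ≤ ι n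
  ι-mono-≤ {m} {n} m≤n rewrite ι≡mkℚ m | ι≡mkℚ n = *≤* (ℤP.*-monoʳ-≤-nonNeg (+ 1) (ℤ.+≤+ m≤n))

  ι-cancel-≤ : ∀ {m n} → ι m ≤ ι n → m ℕ.≤ n
  ι-cancel-≤ {m} {n} ιm≤ιn rewrite ι≡mkℚ m | ι≡mkℚ n with drop-*≤* ιm≤ιn
  ... | m*1≤n*1 rewrite ℤP.*-identityʳ (+ m) | ℤP.*-identityʳ (+ n) = ℤP.drop‿+≤+ m*1≤n*1

  ι-nonNeg : ∀ n → 0ℚ ≤ ι n
  ι-nonNeg n = ι-mono-≤ {0} {n} ℕ.z≤n

  invSuc : ℕ → ℚ
  invSuc d = mkℚ (+ 1) d (Coprime.1-coprimeTo (suc d))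

  invSuc-inverseˡ : ∀ d → invSuc d * ι (suc d) ≡ 1ℚ
  invSuc-inverseˡ d rewrite ι≡mkℚ (suc d) = /-cong-cross (+ 1 ℤ.* + suc d) (+ 1) (d ℕ.* 1) 0 (begin
    + 1 ℤ.* + suc d ℤ.* + 1     ≡⟨ ℤP.*-identityʳ _ ⟩
    + 1 ℤ.* + suc d             ≡⟨ ℤP.*-identityˡ _ ⟩
    + suc d                     ≡⟨ cong (λ e → + suc e) (ℕP.*-identityʳ d) ⟨
    + suc (d ℕ.* 1)             ≡⟨ ℤP.*-identityˡ _ ⟨
    + 1 ℤ.* + suc (d ℕ.* 1)     ∎)
    where open ≡-Reasoning

  mkℚ≡ι*invSuc : ∀ p d .(c : Coprime.Coprime p (suc d)) → mkℚ (+ p) d c ≡ ι p * invSuc d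
  mkℚ≡ι*invSuc p d c rewrite ι≡mkℚ p =
    trans (sym (normalize-coprime c)) (/-cong-cross (+ p) (+ p ℤ.* + 1) d (d ℕ.+ 0) (begin
      + p ℤ.* + suc (d ℕ.+ 0)    ≡⟨ cong (λ e → + p ℤ.* + suc e) (ℕP.+-identityʳ d) ⟩
      + p ℤ.* + suc d            ≡⟨ cong (ℤ._* + suc d) (ℤP.*-identityʳ (+ p)) ⟨
      + p ℤ.* + 1 ℤ.* + suc d    ∎))
    where open ≡-Reasoning

module Counting where
  open import Data.Nat using (_+_; _*_; _∸_; _⊓_; _≤_; _<_; _≤ᵇ_; _<ᵇ_; z≤n; s≤s)
  open import Data.Nat.ListAction using (sum)
  open import Data.List using (List; []; _∷_; map; length)
  open ℕP using (≤-refl; ≤-trans; ≤-reflexive; module ≤-Reasoning)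
  open ℕSum

  indicator : Bool → ℕ
  indicator b = if b then 1 else 0

  count< : ℕ → (ℕ → Bool) → ℕ
  count< m b = ∑< m (λ K → indicator (b K))

  any< : ℕ → (ℕ → Bool) → Bool
  any< zero    f = false
  any< (suc N) f = f N ∨ any< N f

  inInterval : ℕ → ℕ → ℕ → Bool
  inInterval A B K = (A ≤ᵇ K) ∧ (K <ᵇ B)

  inInterval⁺ : ∀ {A B K} → A ≤ K → K < B → T (inInterval A B K)
  inInterval⁺ {A} {B} {K} A≤K K<B = Equivalence.from (T-∧ {A ≤ᵇ K}) (ℕP.≤⇒≤ᵇ A≤K , ℕP.<⇒<ᵇ K<B)

  inInterval⁻ : ∀ A B K → T (inInterval A B K) → A ≤ K × K < B
  inInterval⁻ A B K A≤K<B with Equivalence.to (T-∧ {A ≤ᵇ K}) A≤K<B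
  ... | A≤ᵇK , K<ᵇB = ℕP.≤ᵇ⇒≤ A K A≤ᵇK , ℕP.<ᵇ⇒< K B K<ᵇB

  any<⁺ : ∀ {N} f v → v < N → T (f v) → T (any< N f)
  any<⁺ {suc N} f v v<1+N fv with ℕP.m≤n⇒m<n∨m≡n (ℕP.≤-pred v<1+N)
  ... | inj₁ v<N  = Equivalence.from (T-∨ {f N}) (inj₂ (any<⁺ f v v<N fv))
  ... | inj₂ refl = Equivalence.from (T-∨ {f N}) (inj₁ fv)

  any<⁻ : ∀ N f → T (any< N f) → ∃[ v ] v < N × T (f v)
  any<⁻ (suc N) f any with Equivalence.to (T-∨ {f N}) any
  ... | inj₁ fN = N , ≤-refl , fN
  ... | inj₂ rest with any<⁻ N f rest
  ...   | v , v<N , fv = v , ℕP.m≤n⇒m≤1+n v<N , fv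

  indicator-mono : ∀ {a b} → (T a → T b) → indicator a ≤ indicator b
  indicator-mono {false}        _   = z≤n
  indicator-mono {true} {true}  _   = ≤-refl
  indicator-mono {true} {false} a⇒b = ⊥-elim (a⇒b tt)

  sum-indicator-mono : ∀ {A : Set} {b c : A → Bool} (xs : List A) → (∀ x → T (b x) → T (c x)) →
                       sum (map (λ x → indicator (b x)) xs) ≤ sum (map (λ x → indicator (c x)) xs)
  sum-indicator-mono []       b⇒c = z≤n
  sum-indicator-mono (x ∷ xs) b⇒c = ℕP.+-mono-≤ (indicator-mono (b⇒c x)) (sum-indicator-mono xs b⇒c)

  sum-indicator≤length : ∀ {A : Set} (b : A → Bool) (xs : List A) → sum (map (λ x → indicator (b x)) xs) ≤ length xs
  sum-indicator≤length b []       = z≤n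
  sum-indicator≤length b (x ∷ xs) = ℕP.+-mono-≤ (indicator≤1 (b x)) (sum-indicator≤length b xs)
    where
    indicator≤1 : ∀ b → indicator b ≤ 1
    indicator≤1 true  = ≤-refl
    indicator≤1 false = z≤n

  count<-mono : ∀ m {b c : ℕ → Bool} → (∀ K → T (b K) → T (c K)) → count< m b ≤ count< m c
  count<-mono m b⇒c = ∑<-mono-≤ m (λ K → indicator-mono (b⇒c K))

  count<-monoˡ : ∀ {m m′} b → m ≤ m′ → count< m b ≤ count< m′ b
  count<-monoˡ {m} {m′} b m≤m′ = begin
    count< m b                                      ≤⟨ ℕP.m≤m+n _ _ ⟩
    count< m b + count< (m′ ∸ m) (λ j → b (m + j))  ≡⟨ ∑<-split m (m′ ∸ m) _ ⟨
    count< (m + (m′ ∸ m)) b                         ≡⟨ cong (λ i → count< i b) (ℕP.m+[n∸m]≡n m≤m′) ⟩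
    count< m′ b                                     ∎
    where open ≤-Reasoning

  count<-∧-not : ∀ m (b c : ℕ → Bool) → count< m b ≤ count< m c + count< m (λ K → b K ∧ not (c K))
  count<-∧-not m b c = ≤-trans (∑<-mono-≤ m (λ K → split (b K) (c K))) (≤-reflexive (∑<-distrib-+ m _ _))
    where
    split : ∀ x y → indicator x ≤ indicator y + indicator (x ∧ not y)
    split false _     = z≤n
    split true  true  = ≤-refl
    split true  false = ≤-refl

  indicator-any< : ∀ N f → indicator (any< N f) ≤ ∑< N (λ v → indicator (f v))
  indicator-any< zero    f = z≤n
  indicator-any< (suc N) f = begin
    indicator (f N ∨ any< N f)                      ≤⟨ ∨-bound (f N) (any< N f) ⟩
    indicator (f N) + indicator (any< N f)          ≤⟨ ℕP.+-monoʳ-≤ _ (indicator-any< N f) ⟩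
    indicator (f N) + ∑< N (λ v → indicator (f v))  ≡⟨ ℕP.+-comm (indicator (f N)) _ ⟩
    ∑< (suc N) (λ v → indicator (f v))              ∎
    where
    open ≤-Reasoning
    ∨-bound : ∀ x y → indicator (x ∨ y) ≤ indicator x + indicator y
    ∨-bound true  _ = s≤s z≤n
    ∨-bound false _ = ≤-refl

  count<-any< : ∀ m N (f : ℕ → ℕ → Bool) →
                count< m (λ K → any< N (λ v → f v K)) ≤ ∑< N (λ v → count< m (f v))
  count<-any< m N f = ≤-trans (∑<-mono-≤ m (λ K → indicator-any< N (λ v → f v K)))
                              (≤-reflexive (∑<-comm m N (λ v K → indicator (f v K))))

  count<-inInterval : ∀ m A B → count< m (inInterval A B) ≡ (B ⊓ m) ∸ A
  count<-inInterval zero    A B = sym (trans (cong (_∸ A) (ℕP.⊓-zeroʳ B)) (ℕP.0∸n≡0 A))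
  count<-inInterval (suc m) A B =
    trans (cong (_+ indicator (inInterval A B m)) (count<-inInterval m A B))
          (step (m <ᵇ B) (ℕP.<ᵇ-reflects-< m B))
    where
    enter : ∀ b → Reflects (A ≤ m) b → m ∸ A + indicator b ≡ suc m ∸ A
    enter true  (ofʸ A≤m) = trans (ℕP.+-comm _ 1) (sym (ℕP.+-∸-assoc 1 A≤m))
    enter false (ofⁿ A≰m) = trans (ℕP.+-identityʳ _)
      (trans (ℕP.m≤n⇒m∸n≡0 (ℕP.<⇒≤ (ℕP.≰⇒> A≰m))) (sym (ℕP.m≤n⇒m∸n≡0 (ℕP.≰⇒> A≰m))))
    step : ∀ b → Reflects (m < B) b → (B ⊓ m) ∸ A + indicator ((A ≤ᵇ m) ∧ b) ≡ (B ⊓ suc m) ∸ A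
    step true (ofʸ m<B)
      rewrite ∧-identityʳ (A ≤ᵇ m) | ℕP.m≥n⇒m⊓n≡n (ℕP.<⇒≤ m<B) | ℕP.m≥n⇒m⊓n≡n m<B
      = enter (A ≤ᵇ m) (ℕP.≤ᵇ-reflects-≤ A m)
    step false (ofⁿ m≮B)
      rewrite ∧-zeroʳ (A ≤ᵇ m) | ℕP.m≤n⇒m⊓n≡m (ℕP.≮⇒≥ m≮B)
            | ℕP.m≤n⇒m⊓n≡m (ℕP.m≤n⇒m≤1+n (ℕP.≮⇒≥ m≮B))
      = ℕP.+-identityʳ _

  count<-inInterval-≤ : ∀ {m A B} → B ≤ m → count< m (inInterval A B) ≡ B ∸ A
  count<-inInterval-≤ {m} {A} {B} B≤m = trans (count<-inInterval m A B) (cong (_∸ A) (ℕP.m≤n⇒m⊓n≡m B≤m))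

  ≤-count< : ∀ {m h} (b : ℕ → Bool) → h ≤ m → (∀ ℓ → ℓ < h → T (b ℓ)) → h ≤ count< m b
  ≤-count< {m} {h} b h≤m b-below = begin
    h                          ≡⟨ count<-inInterval-≤ {A = 0} h≤m ⟨
    count< m (inInterval 0 h)  ≤⟨ count<-mono m (λ ℓ ℓ∈ → b-below ℓ (proj₂ (inInterval⁻ 0 h ℓ ℓ∈))) ⟩
    count< m b                 ∎
    where open ≤-Reasoning

  count<-≤ : ∀ {m h} (b : ℕ → Bool) → (∀ ℓ → T (b ℓ) → ℓ < h) → count< m b ≤ h
  count<-≤ {m} {h} b b⇒<h = begin
    count< m b                 ≤⟨ count<-mono m (λ ℓ bℓ → inInterval⁺ z≤n (b⇒<h ℓ bℓ)) ⟩
    count< m (inInterval 0 h)  ≡⟨ count<-inInterval m 0 h ⟩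
    h ⊓ m                      ≤⟨ ℕP.m⊓n≤m h m ⟩
    h                          ∎
    where open ≤-Reasoning

  count<-∧-inInterval : ∀ {m A B} b → B ≤ m → count< m (λ K → b ∧ inInterval A B K) ≡ indicator b * (B ∸ A)
  count<-∧-inInterval {A = A} true B≤m = trans (count<-inInterval-≤ {A = A} B≤m) (sym (ℕP.*-identityˡ _))
  count<-∧-inInterval {m} false _ = ∑<-zero m

module ℚSum where
  open import Algebra.Bundles using (CommutativeRing)
  open RangeSum (CommutativeRing.semiring ℚP.+-*-commutativeRing) public
  open import Data.Rational using (0ℚ; 1ℚ; _+_; _-_; -_; _*_; _≤_)
  open Embedding
  open Counting using (count<; indicator)

  ∑<-neg : ∀ m (f : ℕ → ℚ) → ∑< m (λ K → - f K) ≡ - ∑< m f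
  ∑<-neg zero    f = refl
  ∑<-neg (suc m) f = trans (cong (_- f m) (∑<-neg m f)) (sym (ℚP.neg-distrib-+ (∑< m f) (f m)))

  ∑<-distrib-sub : ∀ m (f h : ℕ → ℚ) → ∑< m (λ K → f K - h K) ≡ ∑< m f - ∑< m h
  ∑<-distrib-sub m f h = trans (∑<-distrib-+ m f (λ K → - h K)) (cong (∑< m f +_) (∑<-neg m h))

  ∑<-mono-≤ : ∀ m {f h : ℕ → ℚ} → (∀ K → f K ≤ h K) → ∑< m f ≤ ∑< m h
  ∑<-mono-≤ zero    f≤h = ℚP.≤-refl
  ∑<-mono-≤ (suc m) f≤h = ℚP.+-mono-≤ (∑<-mono-≤ m f≤h) (f≤h m)

  ∑<-ι : ∀ m (h : ℕ → ℕ) → ∑< m (λ K → ι (h K)) ≡ ι (ℕSum.∑< m h)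
  ∑<-ι zero    h = refl
  ∑<-ι (suc m) h = trans (cong (_+ ι (h m)) (∑<-ι m h)) (sym (ι-homo-+ (ℕSum.∑< m h) (h m)))

  ∑<-if : ∀ m (b : ℕ → Bool) x → ∑< m (λ K → if b K then x else 0ℚ) ≡ ι (count< m b) * x
  ∑<-if zero    b x = sym (ℚP.*-zeroˡ x)
  ∑<-if (suc m) b x rewrite ∑<-if m b x | ι-homo-+ (count< m b) (indicator (b m)) with b m
  ... | true  = trans (cong (ι (count< m b) * x +_) (sym (ℚP.*-identityˡ x))) (sym (ℚP.*-distribʳ-+ x (ι (count< m b)) 1ℚ))
  ... | false = trans (ℚP.+-identityʳ _) (cong (_* x) (sym (ℚP.+-identityʳ (ι (count< m b)))))


module Runs (X : ℕ → Bool) where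
  open import Data.Nat using (_+_; _*_; _∸_; _≤_; _<_; z≤n; s≤s; _≤?_)
  open ℕP using (≤-refl; ≤-trans; ≤-reflexive)
  open Counting
  open ℕSum

  run : ℕ → ℕ
  run zero    = 0
  run (suc s) = if X s then suc (run s) else 0

  run-suc : ∀ {s} → T (X s) → run (suc s) ≡ suc (run s)
  run-suc = if-true

  run≤ : ∀ s → run s ≤ s
  run≤ zero = z≤n
  run≤ (suc s) with X s
  ... | true  = s≤s (run≤ s)
  ... | false = z≤n

  ∸≤run : ∀ a t → (∀ s → a ≤ s → s < t → T (X s)) → t ∸ a ≤ run t
  ∸≤run a zero    _    = ≤-reflexive (ℕP.0∸n≡0 a)
  ∸≤run a (suc t) X-on with a ≤? t
  ... | no a≰t  = ≤-trans (≤-reflexive (ℕP.m≤n⇒m∸n≡0 (ℕP.≰⇒> a≰t))) z≤n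
  ... | yes a≤t rewrite run-suc (X-on t a≤t ≤-refl) | ℕP.+-∸-assoc 1 a≤t =
    s≤s (∸≤run a t (λ s a≤s s<t → X-on s a≤s (ℕP.m≤n⇒m≤1+n s<t)))

  endsRun : ℕ → Bool
  endsRun v = X v ∧ not (X (suc v))

  -- A maximal run ending at v has length run v + 1.
  ∑<-completedRuns : ∀ N → ∑< N (λ v → indicator (endsRun v) * suc (run v)) + indicator (X N) * suc (run N)
                           ≡ count< (suc N) X
  ∑<-completedRuns zero    = ℕP.*-identityʳ (indicator (X 0))
  ∑<-completedRuns (suc N) =
    trans (step (∑< N (λ v → indicator (endsRun v) * suc (run v))) (run N) (X N) (X (suc N)))
          (cong (_+ indicator (X (suc N))) (∑<-completedRuns N))
    where
    open import Data.Nat.Solver using (module +-*-Solver)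
    open +-*-Solver
    step : ∀ S R x y → S + indicator (x ∧ not y) * suc R + indicator y * suc (if x then suc R else 0)
                       ≡ S + indicator x * suc R + indicator y
    step S R true  true  = solve 2 (λ S R → S :+ con 0 :+ con 1 :* (con 2 :+ R) := S :+ con 1 :* (con 1 :+ R) :+ con 1) refl S R
    step S R true  false = refl
    step S R false true  = refl
    step S R false false = refl

  record RunEnd (t : ℕ) : Set where
    field
      end      : ℕ
      t≤end    : t ≤ end
      X-on     : ∀ s → t ≤ s → s ≤ end → T (X s)
      ends     : T (endsRun end)
      run≤run  : run t ≤ run end

  module _ (τ : ℕ) (vanishes : ∀ s → τ < s → X s ≡ false) where

    X⇒≤τ : ∀ {s} → T (X s) → s ≤ τ
    X⇒≤τ {s} Xs with s ≤? τ
    ... | yes s≤τ = s≤τ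
    ... | no s≰τ  = ⊥-elim (subst T (vanishes s (ℕP.≰⇒> s≰τ)) Xs)

    runEnd-within : ∀ k t → τ < t + k → T (X t) → RunEnd t
    runEnd-within zero t τ<t Xt = ⊥-elim (ℕP.<⇒≱ (subst (τ <_) (ℕP.+-identityʳ t) τ<t) (X⇒≤τ Xt))
    runEnd-within (suc k) t τ<t+1+k Xt with X (suc t) in X[1+t]
    ... | false = record
      { end     = t
      ; t≤end   = ≤-refl
      ; X-on    = λ s t≤s s≤t → subst (λ i → T (X i)) (ℕP.≤-antisym t≤s s≤t) Xt
      ; ends    = Equivalence.from (T-∧ {X t}) (Xt , subst (λ b → T (not b)) (sym X[1+t]) tt)
      ; run≤run = ≤-refl
      }
    ... | true = record
      { end     = end
      ; t≤end   = ℕP.<⇒≤ t≤end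
      ; X-on    = X-on′
      ; ends    = ends
      ; run≤run = ≤-trans (ℕP.n≤1+n (run t)) (subst (_≤ run end) (run-suc Xt) run≤run)
      }
      where
      open RunEnd (runEnd-within k (suc t) (subst (τ <_) (ℕP.+-suc t k) τ<t+1+k) (subst T (sym X[1+t]) tt))
      X-on′ : ∀ s → t ≤ s → s ≤ end → T (X s)
      X-on′ s t≤s s≤end with ℕP.m≤n⇒m<n∨m≡n t≤s
      ... | inj₁ t<s  = X-on s t<s s≤end
      ... | inj₂ refl = Xt

    runEnd : ∀ {t} → T (X t) → RunEnd t
    runEnd {t} = runEnd-within (suc τ) t (ℕP.m≤n+m (suc τ) t)

    ∑<-runEnds : ∑< (suc τ) (λ v → indicator (endsRun v) * suc (run v)) ≡ count< (suc τ) X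
    ∑<-runEnds with X (suc τ) | vanishes (suc τ) ≤-refl | ∑<-completedRuns (suc τ)
    ... | .false | refl | runs+0≡count+0 =
      trans (sym (ℕP.+-identityʳ _)) (trans runs+0≡count+0 (ℕP.+-identityʳ _))

module Extension (X : ℕ → Bool) (τ Q k : ℕ) .{{_ : ℕ.NonZero Q}}
                 (vanishes : ∀ s → τ ℕ.< s → X s ≡ false) where
  open import Data.Nat using (_+_; _*_; _≤_; _<_; z≤n; s≤s)
  open import Data.Nat.DivMod using (_/_; m*n/n≡m; /-monoˡ-≤; m<n*o⇒m/o<n)
  open import Algebra.Properties.CommutativeSemigroup ℕP.*-commutativeSemigroup using (x∙yz≈y∙xz)
  open ℕP using (≤-refl; ≤-trans; ≤-reflexive; module ≤-Reasoning)
  open Counting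
  open ℕSum
  open Runs X public

  extension : ℕ → ℕ → Bool
  extension t = inInterval (suc t * Q) (suc t * Q + k * run t)

  extended : ℕ → Bool
  extended K = any< (suc τ) (λ t → X t ∧ extension t K)

  occupied : ℕ → Bool
  occupied K = X (K / Q)

  extendedAfterRunEnd : ℕ → Bool
  extendedAfterRunEnd K = any< (suc τ) (λ v → endsRun v ∧ extension v K)

  -- A vacant cell extended from time t lies past the end of the run through t, and run lengths
  -- only grow along a run, so the extension from the run end reaches the cell as well.
  extended-vacant⇒extendedAfterRunEnd : ∀ K → T (extended K) → ¬ T (occupied K) → T (extendedAfterRunEnd K)
  extended-vacant⇒extendedAfterRunEnd K ext vacant with any<⁻ (suc τ) _ ext
  ... | t , _ , Xt∧ext with Equivalence.to (T-∧ {X t}) Xt∧ext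
  ...   | Xt , t-ext with inInterval⁻ _ _ K t-ext
  ...     | [1+t]Q≤K , K<end =
    any<⁺ _ end (s≤s (X⇒≤τ τ vanishes (X-on end t≤end ≤-refl)))
          (Equivalence.from (T-∧ {endsRun end}) (ends , inInterval⁺ [1+end]Q≤K K<end′))
    where
    open RunEnd (runEnd τ vanishes Xt)
    [1+end]Q≤K : suc end * Q ≤ K
    [1+end]Q≤K = ℕP.≮⇒≥ λ K<[1+end]Q → vacant (X-on (K / Q)
      (ℕP.<⇒≤ (subst (_≤ K / Q) (m*n/n≡m (suc t) Q) (/-monoˡ-≤ Q [1+t]Q≤K)))
      (ℕP.≤-pred (m<n*o⇒m/o<n K<[1+end]Q)))
    K<end′ : K < suc end * Q + k * run end
    K<end′ = ≤-trans K<end (ℕP.+-mono-≤ (ℕP.*-monoˡ-≤ Q (s≤s t≤end)) (ℕP.*-monoʳ-≤ k run≤run))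

  count<-extendedAfterRunEnd : ∀ {M} → suc τ * Q + k * τ ≤ M → count< M extendedAfterRunEnd ≤ k * count< (suc τ) X
  count<-extendedAfterRunEnd {M} M-large = begin
    count< M extendedAfterRunEnd
      ≤⟨ count<-any< M (suc τ) (λ v K → endsRun v ∧ extension v K) ⟩
    ∑< (suc τ) (λ v → count< M (λ K → endsRun v ∧ extension v K))
      ≡⟨ ∑<-cong (suc τ) (λ v v≤τ → trans (count<-∧-inInterval {A = suc v * Q} (endsRun v) (end≤M (ℕP.≤-pred v≤τ)))
                                          (cong (indicator (endsRun v) *_) (ℕP.m+n∸m≡n (suc v * Q) _))) ⟩
    ∑< (suc τ) (λ v → indicator (endsRun v) * (k * run v))
      ≤⟨ ∑<-mono-≤ (suc τ) (λ v → k-out (endsRun v) (run v)) ⟩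
    ∑< (suc τ) (λ v → k * (indicator (endsRun v) * suc (run v)))
      ≡⟨ *-distribˡ-∑< (suc τ) k _ ⟨
    k * ∑< (suc τ) (λ v → indicator (endsRun v) * suc (run v))
      ≡⟨ cong (k *_) (∑<-runEnds τ vanishes) ⟩
    k * count< (suc τ) X ∎
    where
    open ≤-Reasoning
    end≤M : ∀ {v} → v ≤ τ → suc v * Q + k * run v ≤ M
    end≤M v≤τ =
      ≤-trans (ℕP.+-mono-≤ (ℕP.*-monoˡ-≤ Q (s≤s v≤τ)) (ℕP.*-monoʳ-≤ k (≤-trans (run≤ _) v≤τ))) M-large
    k-out : ∀ b R → indicator b * (k * R) ≤ k * (indicator b * suc R)
    k-out true  R = ≤-trans (≤-reflexive (ℕP.+-identityʳ (k * R)))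
                            (ℕP.*-monoʳ-≤ k (≤-trans (ℕP.n≤1+n R) (≤-reflexive (sym (ℕP.+-identityʳ (suc R))))))
    k-out false R = z≤n

  extension-bound : ∀ {M} → suc τ * Q + k * τ ≤ M →
                    Q * count< M (λ K → extended K ∧ not (occupied K)) ≤ k * count< M occupied
  extension-bound {M} M-large = begin
    Q * count< M (λ K → extended K ∧ not (occupied K))
      ≤⟨ ℕP.*-monoʳ-≤ Q (≤-trans (count<-mono M extended-vacant) (count<-extendedAfterRunEnd M-large)) ⟩
    Q * (k * count< (suc τ) X)     ≡⟨ x∙yz≈y∙xz Q k _ ⟩
    k * (Q * count< (suc τ) X)     ≡⟨ cong (k *_) (∑<-blocks Q (suc τ) (λ s → indicator (X s))) ⟨
    k * count< (suc τ * Q) occupied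
      ≤⟨ ℕP.*-monoʳ-≤ k (count<-monoˡ occupied (≤-trans (ℕP.m≤m+n (suc τ * Q) _) M-large)) ⟩
    k * count< M occupied          ∎
    where
    open ≤-Reasoning
    extended-vacant : ∀ K → T (extended K ∧ not (occupied K)) → T (extendedAfterRunEnd K)
    extended-vacant K ext∧vacant with Equivalence.to (T-∧ {extended K}) ext∧vacant
    ... | ext , vacant = extended-vacant⇒extendedAfterRunEnd K ext (T-not⇒¬T vacant)

module Cells (o w : ℚ) .{{_ : ℚ.Positive w}} where
  open import Data.Rational using (0ℚ; _+_; _-_; _*_; _⊔_; _⊓_; _≤_; -_; _≤ᵇ_; NonNegative)
  open import Data.Rational.Properties
  open import Data.Rational.Solver using (module +-*-Solver)
  open import Data.Vec as Vec using (Vec; []; _∷_)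
  open import Data.Vec.Relation.Unary.All as VAll using ([]; _∷_)
  import Data.Vec.Relation.Unary.All.Properties as VAllP
  open import Data.List using (List; []; _∷_; _++_)
  open import Data.List.Relation.Unary.All as LAll using ([]; _∷_)
  open import Data.List.Membership.Propositional using (_∈_)
  open import Data.List.Relation.Unary.Any using (here; there)
  open import Algebra.Bundles using (CommutativeMonoid)
  open import Algebra.Properties.CommutativeSemigroup
    (CommutativeMonoid.commutativeSemigroup Data.Bool.Properties.∧-commutativeMonoid) using (interchange)
  open Embedding
  open Counting using (inInterval; count<-inInterval-≤)
  open ℚSum

  private instance
    w≥0 : NonNegative w
    w≥0 = pos⇒nonNeg w

  ι*w-nonNeg : ∀ n → 0ℚ ≤ ι n * w
  ι*w-nonNeg n = subst (_≤ ι n * w) (*-zeroˡ w) (*-monoʳ-≤-nonNeg w (ι-nonNeg n))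

  -- Cell K is the interval [grid K , grid (suc K)]; profile rs K is the height of the union of rs above it.
  grid : ℕ → ℚ
  grid A = ι A * w + o

  grid-mono-≤ : ∀ {A B} → A ℕ.≤ B → grid A ≤ grid B
  grid-mono-≤ A≤B = +-monoˡ-≤ o (*-monoʳ-≤-nonNeg w (ι-mono-≤ A≤B))

  grid-cancel-≤ : ∀ {A B} → grid A ≤ grid B → A ℕ.≤ B
  grid-cancel-≤ {A} {B} gA≤gB =
    ι-cancel-≤ (*-cancelʳ-≤-pos w (subst₂ _≤_ (cancel A) (cancel B) (+-monoˡ-≤ (- o) gA≤gB)))
    where
    cancel : ∀ X → grid X - o ≡ ι X * w
    cancel X = trans (+-assoc (ι X * w) o (- o)) (trans (cong (ι X * w +_) (+-inverseʳ o)) (+-identityʳ _))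

  grid-+ : ∀ A B → grid (A ℕ.+ B) ≡ grid A + ι B * w
  grid-+ A B = begin
    ι (A ℕ.+ B) * w + o      ≡⟨ cong (λ x → x * w + o) (ι-homo-+ A B) ⟩
    (ι A + ι B) * w + o      ≡⟨ solve 4 (λ a b w o → (a :+ b) :* w :+ o := a :* w :+ o :+ b :* w) refl (ι A) (ι B) w o ⟩
    ι A * w + o + ι B * w    ∎
    where open ≡-Reasoning
          open +-*-Solver

  grid-≤ᵇ : ∀ A B → (grid A ≤ᵇ grid B) ≡ (A ℕ.≤ᵇ B)
  grid-≤ᵇ A B = T-ext (λ gA≤gB → ℕP.≤⇒≤ᵇ (grid-cancel-≤ {A} {B} (≤ᵇ⇒≤ {grid A} {grid B} gA≤gB)))
                      (λ A≤B → ≤⇒≤ᵇ (grid-mono-≤ (ℕP.≤ᵇ⇒≤ A B A≤B)))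

  grid-⊔ : ∀ A B → grid A ⊔ grid B ≡ grid (A ℕ.⊔ B)
  grid-⊔ A B with ℕP.≤-total A B
  ... | inj₁ A≤B = trans (p≤q⇒p⊔q≡q (grid-mono-≤ A≤B)) (cong grid (sym (ℕP.m≤n⇒m⊔n≡n A≤B)))
  ... | inj₂ B≤A = trans (p≥q⇒p⊔q≡p (grid-mono-≤ B≤A)) (cong grid (sym (ℕP.m≥n⇒m⊔n≡m B≤A)))

  grid-⊓ : ∀ A B → grid A ⊓ grid B ≡ grid (A ℕ.⊓ B)
  grid-⊓ A B with ℕP.≤-total A B
  ... | inj₁ A≤B = trans (p≤q⇒p⊓q≡p (grid-mono-≤ A≤B)) (cong grid (sym (ℕP.m≤n⇒m⊓n≡m A≤B)))
  ... | inj₂ B≤A = trans (p≥q⇒p⊓q≡q (grid-mono-≤ B≤A)) (cong grid (sym (ℕP.m≥n⇒m⊓n≡n B≤A)))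

  grid-width : ∀ A B → 0ℚ ⊔ (grid B - grid A) ≡ ι (B ℕ.∸ A) * w
  grid-width A B with ℕP.≤-total A B
  ... | inj₁ A≤B = trans (p≤q⇒p⊔q≡q (subst (0ℚ ≤_) (sym difference) (ι*w-nonNeg (B ℕ.∸ A)))) difference
    where
    difference : grid B - grid A ≡ ι (B ℕ.∸ A) * w
    difference = begin
      grid B - grid A                          ≡⟨ cong (λ X → grid X - grid A) (ℕP.m+[n∸m]≡n A≤B) ⟨
      grid (A ℕ.+ (B ℕ.∸ A)) - grid A          ≡⟨ cong (λ x → x * w + o - grid A) (ι-homo-+ A (B ℕ.∸ A)) ⟩
      (ι A + ι (B ℕ.∸ A)) * w + o - grid A
        ≡⟨ solve 4 (λ a d w o → (a :+ d) :* w :+ o :- (a :* w :+ o) := d :* w) refl (ι A) (ι (B ℕ.∸ A)) w o ⟩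
      ι (B ℕ.∸ A) * w                          ∎
      where open ≡-Reasoning
            open +-*-Solver
  ... | inj₂ B≤A = trans (p≥q⇒p⊔q≡p nonPos) (sym (trans (cong (λ X → ι X * w) (ℕP.m≤n⇒m∸n≡0 B≤A)) (*-zeroˡ w)))
    where
    nonPos : grid B - grid A ≤ 0ℚ
    nonPos = subst (grid B - grid A ≤_) (+-inverseʳ (grid A)) (+-monoˡ-≤ (- grid A) (grid-mono-≤ B≤A))

  covers : Rect → ℕ → Bool
  covers r K = (Rect.x₀ r ≤ᵇ grid K) ∧ (grid (suc K) ≤ᵇ Rect.x₁ r)

  top : Rect → ℚ
  top r = 0ℚ ⊔ Rect.y₁ r

  heightAt : Rect → ℕ → ℚ
  heightAt r K = if covers r K then top r else 0ℚ

  profile : ∀ {m} → Vec Rect m → ℕ → ℚ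
  profile []       K = 0ℚ
  profile (r ∷ rs) K = heightAt r K ⊔ profile rs K

  data Aligned (M : ℕ) : Rect → Set where
    aligned : ∀ {A B y₁} → B ℕ.≤ M → Aligned M (rect (grid A) (grid B) 0ℚ y₁)

  covers-grid : ∀ A B {y₀ y₁} K → covers (rect (grid A) (grid B) y₀ y₁) K ≡ inInterval A B K
  covers-grid A B K = cong₂ _∧_ (grid-≤ᵇ A K) (grid-≤ᵇ (suc K) B)

  top-nonNeg : ∀ r → 0ℚ ≤ top r
  top-nonNeg r = p≤p⊔q 0ℚ (Rect.y₁ r)

  heightAt-nonNeg : ∀ r K → 0ℚ ≤ heightAt r K
  heightAt-nonNeg r K with covers r K
  ... | true  = top-nonNeg r
  ... | false = ≤-refl

  heightAt-≤ : ∀ r K {u} → 0ℚ ≤ u → (T (covers r K) → top r ≤ u) → heightAt r K ≤ u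
  heightAt-≤ r K 0≤u covered⇒≤u with covers r K
  ... | true  = covered⇒≤u tt
  ... | false = 0≤u

  profile-nonNeg : ∀ {m} (rs : Vec Rect m) K → 0ℚ ≤ profile rs K
  profile-nonNeg []       K = ≤-refl
  profile-nonNeg (r ∷ rs) K = p≤q⇒p≤q⊔r (profile rs K) (heightAt-nonNeg r K)

  ⊔-≤ᵇ : ∀ p q r → (p ⊔ q ≤ᵇ r) ≡ (p ≤ᵇ r) ∧ (q ≤ᵇ r)
  ⊔-≤ᵇ p q r = T-ext
    (λ le → let p⊔q≤r = ≤ᵇ⇒≤ {p ⊔ q} {r} le in
            Equivalence.from (T-∧ {p ≤ᵇ r}) (≤⇒≤ᵇ (p⊔q≤r⇒p≤r p q p⊔q≤r) , ≤⇒≤ᵇ (p⊔q≤r⇒q≤r p q p⊔q≤r)))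
    (λ both → let (p≤r , q≤r) = Equivalence.to (T-∧ {p ≤ᵇ r}) both in
              ≤⇒≤ᵇ (⊔-lub (≤ᵇ⇒≤ {p} {r} p≤r) (≤ᵇ⇒≤ {q} {r} q≤r)))

  ≤ᵇ-⊓ : ∀ p q r → (p ≤ᵇ q ⊓ r) ≡ (p ≤ᵇ q) ∧ (p ≤ᵇ r)
  ≤ᵇ-⊓ p q r = T-ext
    (λ le → let p≤q⊓r = ≤ᵇ⇒≤ {p} {q ⊓ r} le in
            Equivalence.from (T-∧ {p ≤ᵇ q}) (≤⇒≤ᵇ (p≤q⊓r⇒p≤q q r p≤q⊓r) , ≤⇒≤ᵇ (p≤q⊓r⇒p≤r q r p≤q⊓r)))
    (λ both → let (p≤q , p≤r) = Equivalence.to (T-∧ {p ≤ᵇ q}) both in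
              ≤⇒≤ᵇ (⊓-glb (≤ᵇ⇒≤ {p} {q} p≤q) (≤ᵇ⇒≤ {p} {r} p≤r)))

  covers-∩ : ∀ r r′ K → covers (r ∩ʳ r′) K ≡ covers r K ∧ covers r′ K
  covers-∩ (rect a b _ _) (rect a′ b′ _ _) K =
    trans (cong₂ _∧_ (⊔-≤ᵇ a a′ (grid K)) (≤ᵇ-⊓ (grid (suc K)) b b′))
          (interchange (a ≤ᵇ grid K) (a′ ≤ᵇ grid K) (grid (suc K) ≤ᵇ b) (grid (suc K) ≤ᵇ b′))

  top-∩ : ∀ r r′ → top (r ∩ʳ r′) ≡ top r ⊓ top r′
  top-∩ (rect _ _ _ y₁) (rect _ _ _ y₁′) = ⊔-distribˡ-⊓ 0ℚ y₁ y₁′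

  heightAt-∩ : ∀ r r′ K → heightAt (r ∩ʳ r′) K ≡ heightAt r K ⊓ heightAt r′ K
  heightAt-∩ r r′ K = trans (cong₂ (λ b h → if b then h else 0ℚ) (covers-∩ r r′ K) (top-∩ r r′))
                            (if-∧ (covers r K) (covers r′ K))
    where
    if-∧ : ∀ x y → (if x ∧ y then top r ⊓ top r′ else 0ℚ) ≡ (if x then top r else 0ℚ) ⊓ (if y then top r′ else 0ℚ)
    if-∧ true  true  = refl
    if-∧ true  false = sym (p≥q⇒p⊓q≡q (top-nonNeg r))
    if-∧ false true  = sym (p≤q⇒p⊓q≡p (top-nonNeg r′))
    if-∧ false false = sym (⊓-idem 0ℚ)

  profile-∩ : ∀ {m} r (rs : Vec Rect m) K → profile (Vec.map (r ∩ʳ_) rs) K ≡ heightAt r K ⊓ profile rs K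
  profile-∩ r []        K = sym (p≥q⇒p⊓q≡q (heightAt-nonNeg r K))
  profile-∩ r (r′ ∷ rs) K = trans (cong₂ _⊔_ (heightAt-∩ r r′ K) (profile-∩ r rs K))
                                  (sym (⊓-distribˡ-⊔ (heightAt r K) (heightAt r′ K) (profile rs K)))

  Aligned-∩ : ∀ {M r r′} → Aligned M r → Aligned M r′ → Aligned M (r ∩ʳ r′)
  Aligned-∩ (aligned {A} {B} B≤M) (aligned {A′} {B′} _) rewrite grid-⊔ A A′ | grid-⊓ B B′ =
    aligned {A = A ℕ.⊔ A′} {B ℕ.⊓ B′} (ℕP.≤-trans (ℕP.m⊓n≤m B B′) B≤M)

  rectArea-aligned : ∀ {M r} → Aligned M r → rectArea r ≡ w * ∑< M (heightAt r)
  rectArea-aligned {M} (aligned {A} {B} {y₁} B≤M) = begin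
    (0ℚ ⊔ (grid B - grid A)) * (0ℚ ⊔ (y₁ - 0ℚ))
      ≡⟨ cong₂ _*_ (grid-width A B) (cong (0ℚ ⊔_) (+-identityʳ y₁)) ⟩
    ι (B ℕ.∸ A) * w * h
      ≡⟨ solve 3 (λ n w h → n :* w :* h := w :* (n :* h)) refl (ι (B ℕ.∸ A)) w h ⟩
    w * (ι (B ℕ.∸ A) * h)                             ≡⟨ cong (λ n → w * (ι n * h)) (count<-inInterval-≤ {A = A} B≤M) ⟨
    w * (ι (Counting.count< M (inInterval A B)) * h)  ≡⟨ cong (w *_) (∑<-if M (inInterval A B) h) ⟨
    w * ∑< M (λ K → if inInterval A B K then h else 0ℚ)
      ≡⟨ cong (w *_) (∑<-cong M (λ K _ → cong (λ b → if b then h else 0ℚ) (sym (covers-grid A B {0ℚ} {y₁} K)))) ⟩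
    w * ∑< M (heightAt (rect (grid A) (grid B) 0ℚ y₁)) ∎
    where
    open ≡-Reasoning
    open +-*-Solver
    h = 0ℚ ⊔ y₁

  ⊔≡+-⊓ : ∀ p q → p ⊔ q ≡ p + q - p ⊓ q
  ⊔≡+-⊓ p q with ≤-total p q
  ... | inj₁ p≤q rewrite p≤q⇒p⊔q≡q p≤q | p≤q⇒p⊓q≡p p≤q = solve 2 (λ p q → q := p :+ q :- p) refl p q
    where open +-*-Solver
  ... | inj₂ q≤p rewrite p≥q⇒p⊔q≡p q≤p | p≥q⇒p⊓q≡q q≤p = solve 2 (λ p q → p := p :+ q :- q) refl p q
    where open +-*-Solver

  unionAreaV-aligned : ∀ {M m} {rs : Vec Rect m} → VAll.All (Aligned M) rs → unionAreaV m rs ≡ w * ∑< M (profile rs)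
  unionAreaV-aligned {M} [] = sym (trans (cong (w *_) (∑<-zero M)) (*-zeroʳ w))
  unionAreaV-aligned {M} {suc m} {r ∷ rs} (ar ∷ ars) = begin
    rectArea r + unionAreaV m rs - unionAreaV m (Vec.map (r ∩ʳ_) rs)
      ≡⟨ cong₂ _-_ (cong₂ _+_ (rectArea-aligned ar) (unionAreaV-aligned ars))
                   (unionAreaV-aligned (VAllP.map⁺ (VAll.map (Aligned-∩ ar) ars))) ⟩
    w * ∑< M (heightAt r) + w * ∑< M (profile rs) - w * ∑< M (profile (Vec.map (r ∩ʳ_) rs))
      ≡⟨ solve 4 (λ w a b c → w :* a :+ w :* b :- w :* c := w :* (a :+ b :- c)) refl w _ _ _ ⟩
    w * (∑< M (heightAt r) + ∑< M (profile rs) - ∑< M (profile (Vec.map (r ∩ʳ_) rs)))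
      ≡⟨ cong (w *_) (trans (∑<-distrib-sub M _ _) (cong (_- ∑< M (profile (Vec.map (r ∩ʳ_) rs)))
                                                         (∑<-distrib-+ M (heightAt r) (profile rs)))) ⟨
    w * ∑< M (λ K → heightAt r K + profile rs K - profile (Vec.map (r ∩ʳ_) rs) K)
      ≡⟨ cong (w *_) (∑<-cong M (λ K _ → trans (cong (λ x → heightAt r K + profile rs K - x) (profile-∩ r rs K))
                                                (sym (⊔≡+-⊓ (heightAt r K) (profile rs K))))) ⟩
    w * ∑< M (profile (r ∷ rs)) ∎
    where
    open ≡-Reasoning
    open +-*-Solver

  Area-aligned : ∀ {M} {rs : List Rect} → LAll.All (Aligned M) rs → Area rs ≡ w * ∑< M (profile (Vec.fromList rs))
  Area-aligned ars = unionAreaV-aligned (VAllP.fromList⁺ ars)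

  profile-++ : ∀ xs ys K → profile (Vec.fromList (xs ++ ys)) K ≡ profile (Vec.fromList xs) K ⊔ profile (Vec.fromList ys) K
  profile-++ []       ys K = sym (p≤q⇒p⊔q≡q (profile-nonNeg (Vec.fromList ys) K))
  profile-++ (x ∷ xs) ys K = trans (cong (heightAt x K ⊔_) (profile-++ xs ys K))
                                   (sym (⊔-assoc (heightAt x K) _ _))

  heightAt≤profile : ∀ {r rs} K → r ∈ rs → heightAt r K ≤ profile (Vec.fromList rs) K
  heightAt≤profile {r} {_ ∷ rs} K (here refl) = p≤p⊔q (heightAt r K) _
  heightAt≤profile {r} {r′ ∷ _} K (there r∈rs) = p≤q⇒p≤r⊔q (heightAt r′ K) (heightAt≤profile K r∈rs)

  profile-≤ : ∀ {u} rs K → 0ℚ ≤ u → LAll.All (λ r → heightAt r K ≤ u) rs → profile (Vec.fromList rs) K ≤ u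
  profile-≤ []       K 0≤u []           = 0≤u
  profile-≤ (r ∷ rs) K 0≤u (r≤u ∷ rs≤u) = ⊔-lub r≤u (profile-≤ rs K 0≤u rs≤u)

module Arithmetic where
  open import Data.Integer using (+_)
  open import Data.Rational using (0ℚ; 1ℚ; _+_; _-_; _*_; _/_; _⊔_; _≤_; _<_; -_; nonNegative)
  open import Data.Rational.Properties
  open import Data.Rational.Solver using (module +-*-Solver)
  open +-*-Solver
  open Embedding

  p⊔q-q≤u-v : ∀ {p q u v} → p ≤ u → v ≤ q → v ≤ u → p ⊔ q - q ≤ u - v
  p⊔q-q≤u-v {p} {q} {u} {v} p≤u v≤q v≤u with ≤-total p q
  ... | inj₁ p≤q = subst (_≤ u - v) (sym (trans (cong (_- q) (p≤q⇒p⊔q≡q p≤q)) (+-inverseʳ q)))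
                         (subst (_≤ u - v) (+-inverseʳ v) (+-monoˡ-≤ (- v) v≤u))
  ... | inj₂ q≤p = subst (_≤ u - v) (cong (_- q) (sym (p≥q⇒p⊔q≡p q≤p))) (+-mono-≤ p≤u (neg-antimono-≤ v≤q))

  3*ε≤1 : ∀ {ε} → ε < + 1 / 3 → ι 3 * ε ≤ 1ℚ
  3*ε≤1 ε<⅓ = *-monoˡ-≤-nonNeg (ι 3) (<⇒≤ ε<⅓)

  stretched-excess : ∀ {ε x y} → 0ℚ ≤ ε → ι 3 * ε ≤ 1ℚ → 0ℚ ≤ x → y ≤ ι 3 * ε * x →
                     (ι 1 + ι 3 * ε) * (x + y) - x ≤ ι 9 * ε * x
  stretched-excess {ε} {x} {y} 0≤ε 3ε≤1 0≤x y≤3εx = begin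
    (ι 1 + ι 3 * ε) * (x + y) - x
      ≡⟨ solve 3 (λ ε x y → (con 1ℚ :+ con (ι 3) :* ε) :* (x :+ y) :- x
                          := con (ι 3) :* ε :* x :+ (con 1ℚ :+ con (ι 3) :* ε) :* y) refl ε x y ⟩
    ι 3 * ε * x + (1ℚ + ι 3 * ε) * y
      ≤⟨ +-monoʳ-≤ (ι 3 * ε * x) (*-monoˡ-≤-nonNeg (1ℚ + ι 3 * ε) {{nonNegative 0≤1+3ε}} y≤3εx) ⟩
    ι 3 * ε * x + (1ℚ + ι 3 * ε) * (ι 3 * ε * x)
      ≤⟨ +-monoʳ-≤ (ι 3 * ε * x) (*-monoʳ-≤-nonNeg (ι 3 * ε * x) {{nonNegative 0≤3εx}} (+-monoʳ-≤ 1ℚ 3ε≤1)) ⟩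
    ι 3 * ε * x + (1ℚ + 1ℚ) * (ι 3 * ε * x)
      ≡⟨ solve 2 (λ ε x → con (ι 3) :* ε :* x :+ (con 1ℚ :+ con 1ℚ) :* (con (ι 3) :* ε :* x)
                        := con (ι 9) :* ε :* x) refl ε x ⟩
    ι 9 * ε * x ∎
    where
    open ≤-Reasoning
    0≤3ε : 0ℚ ≤ ι 3 * ε
    0≤3ε = subst (_≤ ι 3 * ε) (*-zeroʳ (ι 3)) (*-monoˡ-≤-nonNeg (ι 3) 0≤ε)
    0≤1+3ε : 0ℚ ≤ 1ℚ + ι 3 * ε
    0≤1+3ε = +-mono-≤ (ι-nonNeg 1) 0≤3ε
    0≤3εx : 0ℚ ≤ ι 3 * ε * x
    0≤3εx = subst (_≤ ι 3 * ε * x) (*-zeroʳ (ι 3 * ε)) (*-monoˡ-≤-nonNeg (ι 3 * ε) {{nonNegative 0≤3ε}} 0≤x)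

module QueueHeights {n : ℕ} (Qu : Queue n) where
  open import Data.Nat using (_≤_; _≤ᵇ_)
  open import Data.Fin using (toℕ)
  open import Data.List using (allFin)
  open import Data.List.Properties using (length-tabulate)
  open Counting using (sum-indicator-mono; sum-indicator≤length)
  open Queue Qu

  present?⇒Present : ∀ j t → T (present? Qu j t) → Present Qu j t
  present?⇒Present j t present with Equivalence.to (T-∧ {arr j ≤ᵇ t}) present
  ... | a≤t , t<d = ℕP.≤ᵇ⇒≤ (arr j) t a≤t , ℕP.<ᵇ⇒< t (dep j) t<d

  Present⇒present? : ∀ {j t} → Present Qu j t → T (present? Qu j t)
  Present⇒present? {j} {t} (a≤t , t<d) = Equivalence.from (T-∧ {arr j ≤ᵇ t}) (ℕP.≤⇒≤ᵇ a≤t , ℕP.<⇒<ᵇ t<d)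

  heightOf≤n : ∀ i t → heightOf Qu i t ≤ n
  heightOf≤n i t = ℕP.≤-trans (sum-indicator≤length _ (allFin n)) (ℕP.≤-reflexive (length-tabulate (λ j → j)))

  heightOf≤height : ∀ i t s → arr i ≤ s → s ≤ t → heightOf Qu i t ≤ height Qu s
  heightOf≤height i t s aᵢ≤s s≤t = sum-indicator-mono (allFin n) ahead⇒present
    where
    ahead⇒present : ∀ j → T ((toℕ j ≤ᵇ toℕ i) ∧ present? Qu j t) → T (present? Qu j s)
    ahead⇒present j ahead with Equivalence.to (T-∧ {toℕ j ≤ᵇ toℕ i}) ahead
    ... | j≤i , present with present?⇒Present j t present
    ...   | _ , t<dⱼ = Present⇒present? (ℕP.≤-trans (fifoArr j i (ℕP.≤ᵇ⇒≤ (toℕ j) (toℕ i) j≤i)) aᵢ≤s ,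
                                         ℕP.≤-<-trans s≤t t<dⱼ)

module PingArea {n : ℕ} (Qu : Queue n) (τ d p : ℕ) (ε : ℚ) (ε≡p/Q : ε ≡ ι p ℚ.* Embedding.invSuc d) where
  open import Data.Rational using (0ℚ; 1ℚ; _+_; _-_; _*_; _≤_; -_; nonNegative)
  open import Data.Rational.Properties
  open import Data.Rational.Solver using (module +-*-Solver)
  open import Data.Nat.DivMod using (_/_; m/n*n≤m; m%n<n; m≡m%n+[m/n]*n)
  open import Data.Fin using (Fin)
  open import Data.List using (List; _++_)
  open import Data.List.Relation.Unary.All as LAll using (All)
  import Data.List.Relation.Unary.All.Properties as LAllP
  open import Data.List.Membership.Propositional.Properties using (∈-map⁺; ∈-upTo⁺)
  open import Data.Vec using (fromList)
  open +-*-Solver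
  open Embedding
  open Counting
  open ℚSum
  open Arithmetic
  open QueueHeights Qu
  open Queue Qu

  Q : ℕ
  Q = suc d

  w : ℚ
  w = invSuc d

  M : ℕ
  M = suc τ ℕ.* Q ℕ.+ 3 ℕ.* p ℕ.* τ

  -- With offset -1 and cell width 1/Q the column (t - 1, t] consists of the cells tQ, …, (t+1)Q - 1,
  -- and the rectangle of a ping at time t starts at cell (t+1)Q; all of them end before cell M.
  open Cells (- 1ℚ) w

  private instance
    w≥0 : ℚ.NonNegative w
    w≥0 = pos⇒nonNeg w

  occupiedAt : ℕ → ℕ → Bool
  occupiedAt ℓ s = (s ℕ.≤ᵇ τ) ∧ (ℓ ℕ.<ᵇ height Qu s)

  occupiedAt-vanishes : ∀ ℓ s → τ ℕ.< s → occupiedAt ℓ s ≡ false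
  occupiedAt-vanishes ℓ s τ<s =
    cong (_∧ (ℓ ℕ.<ᵇ height Qu s)) (T-ext (λ s≤τ → ⊥-elim (ℕP.<⇒≱ τ<s (ℕP.≤ᵇ⇒≤ s τ s≤τ))) λ ())

  module Level (ℓ : ℕ) = Extension (occupiedAt ℓ) τ Q (3 ℕ.* p) (occupiedAt-vanishes ℓ)

  occupiedLevels extendedLevels excessLevels : ℕ → ℕ
  occupiedLevels K = count< n (λ ℓ → Level.occupied ℓ K)
  extendedLevels K = count< n (λ ℓ → Level.extended ℓ K)
  excessLevels   K = count< n (λ ℓ → Level.extended ℓ K ∧ not (Level.occupied ℓ K))

  stretch : ℚ
  stretch = ι 1 + ι 3 * ε

  column : ℕ → Rect
  column t = rect (ι t - ι 1) (ι t) 0ℚ (ι (height Qu t))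

  H : Region
  H = heightDiagram Qu τ

  ValidPing : Fin n × ℕ → Set
  ValidPing pg = proj₂ pg ℕ.≤ τ × Present Qu (proj₁ pg) (proj₂ pg)

  0≤ε : 0ℚ ≤ ε
  0≤ε = subst (0ℚ ≤_) (sym ε≡p/Q) (ι*w-nonNeg p)

  1≤stretch : 1ℚ ≤ stretch
  1≤stretch = subst (_≤ stretch) (+-identityʳ 1ℚ)
    (+-monoʳ-≤ 1ℚ (subst (_≤ ι 3 * ε) (*-zeroʳ (ι 3)) (*-monoˡ-≤-nonNeg (ι 3) 0≤ε)))

  stretch-mono-≤ : ∀ {x y} → x ≤ y → stretch * x ≤ stretch * y
  stretch-mono-≤ = *-monoˡ-≤-nonNeg stretch {{nonNegative (≤-trans (ι-nonNeg 1) 1≤stretch)}}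

  ≤-stretch : ∀ {x} → 0ℚ ≤ x → x ≤ stretch * x
  ≤-stretch {x} 0≤x = subst (_≤ stretch * x) (*-identityˡ x) (*-monoʳ-≤-nonNeg x {{nonNegative 0≤x}} 1≤stretch)

  0≤stretch*ι : ∀ m → 0ℚ ≤ stretch * ι m
  0≤stretch*ι m = ≤-trans (ι-nonNeg m) (≤-stretch (ι-nonNeg m))

  ι*w≡ι : ∀ t → ι (t ℕ.* Q) * w ≡ ι t
  ι*w≡ι t = begin
    ι (t ℕ.* Q) * w   ≡⟨ cong (_* w) (ι-homo-* t Q) ⟩
    ι t * ι Q * w     ≡⟨ *-assoc (ι t) (ι Q) w ⟩
    ι t * (ι Q * w)   ≡⟨ cong (ι t *_) (trans (*-comm (ι Q) w) (invSuc-inverseˡ d)) ⟩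
    ι t * 1ℚ          ≡⟨ *-identityʳ (ι t) ⟩
    ι t               ∎
    where open ≡-Reasoning

  grid-start : ∀ t → grid (t ℕ.* Q) ≡ ι t - ι 1
  grid-start t = cong (_- 1ℚ) (ι*w≡ι t)

  grid-end : ∀ t → grid (suc t ℕ.* Q) ≡ ι t
  grid-end t = begin
    ι (suc t ℕ.* Q) * w - 1ℚ   ≡⟨ cong (_- 1ℚ) (trans (ι*w≡ι (suc t)) (ι-homo-+ 1 t)) ⟩
    1ℚ + ι t - 1ℚ             ≡⟨ solve 1 (λ x → con 1ℚ :+ x :- con 1ℚ := x) refl (ι t) ⟩
    ι t                       ∎
    where open ≡-Reasoning

  extension-width : ∀ v → ι (3 ℕ.* p ℕ.* v) * w ≡ ι 3 * ε * ι v
  extension-width v = begin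
    ι (3 ℕ.* p ℕ.* v) * w       ≡⟨ cong (_* w) (trans (ι-homo-* (3 ℕ.* p) v) (cong (_* ι v) (ι-homo-* 3 p))) ⟩
    ι 3 * ι p * ι v * w         ≡⟨ solve 4 (λ a b c w → a :* b :* c :* w := a :* (b :* w) :* c) refl (ι 3) (ι p) (ι v) w ⟩
    ι 3 * (ι p * w) * ι v       ≡⟨ cong (λ x → ι 3 * x * ι v) ε≡p/Q ⟨
    ι 3 * ε * ι v               ∎
    where open ≡-Reasoning

  column≡ : ∀ t → column t ≡ rect (grid (t ℕ.* Q)) (grid (suc t ℕ.* Q)) 0ℚ (ι (height Qu t))
  column≡ t = sym (cong₂ (λ a b → rect a b 0ℚ (ι (height Qu t))) (grid-start t) (grid-end t))

  ping≡ : ∀ i t → pingRect Qu ε (i , t) ≡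
          rect (grid (suc t ℕ.* Q)) (grid (suc t ℕ.* Q ℕ.+ 3 ℕ.* p ℕ.* waitOf Qu i t)) 0ℚ (stretch * ι (heightOf Qu i t))
  ping≡ i t = sym (cong₂ (λ a b → rect a b 0ℚ (stretch * ι (heightOf Qu i t))) (grid-end t)
    (trans (grid-+ (suc t ℕ.* Q) _) (cong₂ _+_ (grid-end t) (extension-width (waitOf Qu i t)))))

  column-aligned : ∀ {t} → t ℕ.< suc τ → Aligned M (column t)
  column-aligned {t} t<1+τ = subst (Aligned M) (sym (column≡ t))
    (aligned {A = t ℕ.* Q} (ℕP.≤-trans (ℕP.*-monoˡ-≤ Q t<1+τ) (ℕP.m≤m+n _ _)))

  ping-aligned : ∀ {i t} → t ℕ.≤ τ → Aligned M (pingRect Qu ε (i , t))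
  ping-aligned {i} {t} t≤τ = subst (Aligned M) (sym (ping≡ i t))
    (aligned {A = suc t ℕ.* Q} (ℕP.+-mono-≤ (ℕP.*-monoˡ-≤ Q (ℕ.s≤s t≤τ))
                                            (ℕP.*-monoʳ-≤ (3 ℕ.* p) (ℕP.≤-trans (ℕP.m∸n≤m t (arr i)) t≤τ))))

  H-aligned : All (Aligned M) H
  H-aligned = LAllP.map⁺ (LAllP.applyUpTo⁺₁ (λ t → t) (suc τ) column-aligned)

  pings-aligned : ∀ {pings} → All ValidPing pings → All (Aligned M) (pingRegion Qu ε pings)
  pings-aligned valid = LAllP.map⁺ (LAll.map (λ valid-pg → ping-aligned (proj₁ valid-pg)) valid)

  occupiedLevels≤column : ∀ K → ι (occupiedLevels K) ≤ heightAt (column (K / Q)) K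
  occupiedLevels≤column K = begin
    ι (occupiedLevels K)       ≤⟨ ι-mono-≤ (count<-≤ {m = n} _ below-height) ⟩
    ι (height Qu s)            ≤⟨ p≤q⊔p 0ℚ _ ⟩
    top (column s)             ≡⟨ if-true covered ⟨
    heightAt (column s) K      ∎
    where
    open ≤-Reasoning
    s = K / Q
    below-height : ∀ ℓ → T (occupiedAt ℓ s) → ℓ ℕ.< height Qu s
    below-height ℓ occ = ℕP.<ᵇ⇒< ℓ (height Qu s) (proj₂ (Equivalence.to (T-∧ {s ℕ.≤ᵇ τ}) occ))
    K<[1+s]Q : K ℕ.< suc s ℕ.* Q
    K<[1+s]Q = subst (ℕ._< suc s ℕ.* Q) (sym (m≡m%n+[m/n]*n K Q)) (ℕP.+-monoˡ-< (s ℕ.* Q) (m%n<n K Q))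
    covered : T (covers (column s) K)
    covered = subst (λ r → T (covers r K)) (sym (column≡ s))
                (subst T (sym (covers-grid (s ℕ.* Q) (suc s ℕ.* Q) {0ℚ} {ι (height Qu s)} K))
                         (inInterval⁺ (m/n*n≤m K Q) K<[1+s]Q))

  occupiedLevels-beyond : ∀ K → τ ℕ.< K / Q → occupiedLevels K ≡ 0
  occupiedLevels-beyond K τ<s = ℕP.n≤0⇒n≡0 (count<-≤ {m = n} {h = 0} _ λ ℓ occ →
    ⊥-elim (subst T (occupiedAt-vanishes ℓ (K / Q) τ<s) occ))

  occupiedLevels≤profile : ∀ K → ι (occupiedLevels K) ≤ profile (fromList H) K
  occupiedLevels≤profile K = [ within , beyond ]′ (ℕP.≤-<-connex (K / Q) τ)
    where
    within : K / Q ℕ.≤ τ → ι (occupiedLevels K) ≤ profile (fromList H) K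
    within s≤τ = ≤-trans (occupiedLevels≤column K)
                         (heightAt≤profile {rs = H} K (∈-map⁺ column (∈-upTo⁺ (ℕ.s≤s s≤τ))))
    beyond : τ ℕ.< K / Q → ι (occupiedLevels K) ≤ profile (fromList H) K
    beyond τ<s = subst (λ m → ι m ≤ profile (fromList H) K) (sym (occupiedLevels-beyond K τ<s)) (profile-nonNeg (fromList H) K)

  ping≤stretch : ∀ K {pg} → ValidPing pg → heightAt (pingRect Qu ε pg) K ≤ stretch * ι (extendedLevels K)
  ping≤stretch K {i , t} (t≤τ , present) =
    heightAt-≤ (pingRect Qu ε (i , t)) K (0≤stretch*ι (extendedLevels K)) λ cov →
      ⊔-lub (0≤stretch*ι (extendedLevels K)) (stretch-mono-≤ (ι-mono-≤ (≤-count< _ (heightOf≤n i t) (extended (K∈ cov)))))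
    where
    K∈ : T (covers (pingRect Qu ε (i , t)) K) →
         suc t ℕ.* Q ℕ.≤ K × K ℕ.< suc t ℕ.* Q ℕ.+ 3 ℕ.* p ℕ.* waitOf Qu i t
    K∈ cov = inInterval⁻ A B K (subst T (covers-grid A B {0ℚ} {stretch * ι (heightOf Qu i t)} K)
                                        (subst (λ r → T (covers r K)) (ping≡ i t) cov))
      where
      A = suc t ℕ.* Q
      B = A ℕ.+ 3 ℕ.* p ℕ.* waitOf Qu i t
    extended : suc t ℕ.* Q ℕ.≤ K × K ℕ.< suc t ℕ.* Q ℕ.+ 3 ℕ.* p ℕ.* waitOf Qu i t →
               ∀ ℓ → ℓ ℕ.< heightOf Qu i t → T (Level.extended ℓ K)
    extended (lo , hi) ℓ ℓ<h =
      any<⁺ _ t (ℕ.s≤s t≤τ) (Equivalence.from (T-∧ {occupiedAt ℓ t})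
        (occupied-since t (proj₁ present) ℕP.≤-refl ,
         inInterval⁺ lo (ℕP.≤-trans hi (ℕP.+-monoʳ-≤ (suc t ℕ.* Q) (ℕP.*-monoʳ-≤ (3 ℕ.* p) wait≤run)))))
      where
      occupied-since : ∀ s → arr i ℕ.≤ s → s ℕ.≤ t → T (occupiedAt ℓ s)
      occupied-since s aᵢ≤s s≤t = Equivalence.from (T-∧ {s ℕ.≤ᵇ τ})
        (ℕP.≤⇒≤ᵇ (ℕP.≤-trans s≤t t≤τ) , ℕP.<⇒<ᵇ (ℕP.≤-trans ℓ<h (heightOf≤height i t s aᵢ≤s s≤t)))
      wait≤run : waitOf Qu i t ℕ.≤ Level.run ℓ t
      wait≤run = Level.∸≤run ℓ (arr i) t (λ s aᵢ≤s s<t → occupied-since s aᵢ≤s (ℕP.<⇒≤ s<t))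

  excess : ℕ → ℚ
  excess K = stretch * (ι (occupiedLevels K) + ι (excessLevels K)) - ι (occupiedLevels K)

  profile-excess : ∀ {pings} → All ValidPing pings → ∀ K →
                   profile (fromList (pingRegion Qu ε pings ++ H)) K - profile (fromList H) K ≤ excess K
  profile-excess {pings} valid K =
    subst (λ x → x - profile (fromList H) K ≤ excess K) (sym (profile-++ (pingRegion Qu ε pings) H K))
      (p⊔q-q≤u-v pings≤ (occupiedLevels≤profile K) occupied≤)
    where
    levels : ι (extendedLevels K) ≤ ι (occupiedLevels K) + ι (excessLevels K)
    levels = subst (ι (extendedLevels K) ≤_) (ι-homo-+ (occupiedLevels K) (excessLevels K))
               (ι-mono-≤ (count<-∧-not n (λ ℓ → Level.extended ℓ K) (λ ℓ → Level.occupied ℓ K)))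
    pings≤ : profile (fromList (pingRegion Qu ε pings)) K ≤ stretch * (ι (occupiedLevels K) + ι (excessLevels K))
    pings≤ = ≤-trans (profile-≤ (pingRegion Qu ε pings) K (0≤stretch*ι (extendedLevels K))
                                (LAllP.map⁺ (LAll.map (ping≤stretch K) valid)))
                     (stretch-mono-≤ levels)
    occupied≤ : ι (occupiedLevels K) ≤ stretch * (ι (occupiedLevels K) + ι (excessLevels K))
    occupied≤ = ≤-trans (subst (_≤ ι (occupiedLevels K) + ι (excessLevels K)) (+-identityʳ _)
                                (+-monoʳ-≤ (ι (occupiedLevels K)) (ι-nonNeg (excessLevels K))))
                        (≤-stretch (+-mono-≤ (ι-nonNeg (occupiedLevels K)) (ι-nonNeg (excessLevels K))))

  occupiedSum excessSum : ℕ
  occupiedSum = ℕSum.∑< M occupiedLevels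
  excessSum   = ℕSum.∑< M excessLevels

  ∑<-excess : ∑< M excess ≡ stretch * (ι occupiedSum + ι excessSum) - ι occupiedSum
  ∑<-excess = begin
    ∑< M excess
      ≡⟨ ∑<-distrib-sub M _ _ ⟩
    ∑< M (λ K → stretch * (ι (occupiedLevels K) + ι (excessLevels K))) - ∑< M (λ K → ι (occupiedLevels K))
      ≡⟨ cong₂ _-_ (sym (*-distribˡ-∑< M stretch _)) (∑<-ι M occupiedLevels) ⟩
    stretch * ∑< M (λ K → ι (occupiedLevels K) + ι (excessLevels K)) - ι occupiedSum
      ≡⟨ cong (λ x → stretch * x - ι occupiedSum)
              (trans (∑<-distrib-+ M _ _) (cong₂ _+_ (∑<-ι M occupiedLevels) (∑<-ι M excessLevels))) ⟩
    stretch * (ι occupiedSum + ι excessSum) - ι occupiedSum ∎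
    where open ≡-Reasoning

  Q*excessSum≤ : Q ℕ.* excessSum ℕ.≤ 3 ℕ.* p ℕ.* occupiedSum
  Q*excessSum≤ = begin
    Q ℕ.* excessSum
      ≡⟨ cong (Q ℕ.*_) (ℕSum.∑<-comm M n (λ ℓ K → indicator (Level.extended ℓ K ∧ not (Level.occupied ℓ K)))) ⟩
    Q ℕ.* ℕSum.∑< n (λ ℓ → count< M (λ K → Level.extended ℓ K ∧ not (Level.occupied ℓ K)))
      ≡⟨ ℕSum.*-distribˡ-∑< n Q _ ⟩
    ℕSum.∑< n (λ ℓ → Q ℕ.* count< M (λ K → Level.extended ℓ K ∧ not (Level.occupied ℓ K)))
      ≤⟨ ℕSum.∑<-mono-≤ n (λ ℓ → Level.extension-bound ℓ ℕP.≤-refl) ⟩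
    ℕSum.∑< n (λ ℓ → 3 ℕ.* p ℕ.* count< M (Level.occupied ℓ))
      ≡⟨ ℕSum.*-distribˡ-∑< n (3 ℕ.* p) _ ⟨
    3 ℕ.* p ℕ.* ℕSum.∑< n (λ ℓ → count< M (Level.occupied ℓ))
      ≡⟨ cong (3 ℕ.* p ℕ.*_) (ℕSum.∑<-comm M n (λ ℓ K → indicator (Level.occupied ℓ K))) ⟨
    3 ℕ.* p ℕ.* occupiedSum ∎
    where open ℕP.≤-Reasoning

  excessSum≤ : ι excessSum ≤ ι 3 * ε * ι occupiedSum
  excessSum≤ = begin
    ι excessSum                      ≡⟨ trans (cong (_* ι excessSum) (invSuc-inverseˡ d)) (*-identityˡ _) ⟨
    w * ι Q * ι excessSum            ≡⟨ trans (*-assoc w (ι Q) _) (cong (w *_) (sym (ι-homo-* Q excessSum))) ⟩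
    w * ι (Q ℕ.* excessSum)          ≤⟨ *-monoˡ-≤-nonNeg w (ι-mono-≤ Q*excessSum≤) ⟩
    w * ι (3 ℕ.* p ℕ.* occupiedSum)  ≡⟨ trans (*-comm w (ι (3 ℕ.* p ℕ.* occupiedSum))) (extension-width occupiedSum) ⟩
    ι 3 * ε * ι occupiedSum          ∎
    where open ≤-Reasoning

  pingArea-bound : ι 3 * ε ≤ 1ℚ → ∀ pings → All ValidPing pings →
                   AreaDiff (pingRegion Qu ε pings) H ≤ ι 9 * ε * Area H
  pingArea-bound 3ε≤1 pings valid = begin
    Area (R ++ H) - Area H
      ≡⟨ cong₂ _-_ (Area-aligned (LAllP.++⁺ (pings-aligned valid) H-aligned)) (Area-aligned H-aligned) ⟩
    w * ∑< M (profile (fromList (R ++ H))) - w * ∑< M (profile (fromList H))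
      ≡⟨ trans (cong (w *_) (∑<-distrib-sub M _ _)) (solve 3 (λ w a b → w :* (a :- b) := w :* a :- w :* b) refl w
                                                   (∑< M (profile (fromList (R ++ H)))) (∑< M (profile (fromList H)))) ⟨
    w * ∑< M (λ K → profile (fromList (R ++ H)) K - profile (fromList H) K)
      ≤⟨ *-monoˡ-≤-nonNeg w (∑<-mono-≤ M (profile-excess valid)) ⟩
    w * ∑< M excess
      ≡⟨ cong (w *_) ∑<-excess ⟩
    w * (stretch * (ι occupiedSum + ι excessSum) - ι occupiedSum)
      ≤⟨ *-monoˡ-≤-nonNeg w (stretched-excess 0≤ε 3ε≤1 (ι-nonNeg occupiedSum) excessSum≤) ⟩
    w * (ι 9 * ε * ι occupiedSum)
      ≡⟨ solve 3 (λ w e s → w :* (con (ι 9) :* e :* s) := con (ι 9) :* e :* (w :* s)) refl w ε (ι occupiedSum) ⟩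
    ι 9 * ε * (w * ι occupiedSum)
      ≤⟨ *-monoˡ-≤-nonNeg (ι 9 * ε) {{nonNegative 0≤9ε}} (*-monoˡ-≤-nonNeg w occupiedSum≤) ⟩
    ι 9 * ε * (w * ∑< M (profile (fromList H)))
      ≡⟨ cong (ι 9 * ε *_) (Area-aligned H-aligned) ⟨
    ι 9 * ε * Area H ∎
    where
    open ≤-Reasoning
    R = pingRegion Qu ε pings
    occupiedSum≤ : ι occupiedSum ≤ ∑< M (profile (fromList H))
    occupiedSum≤ = subst (_≤ ∑< M (profile (fromList H))) (∑<-ι M occupiedLevels) (∑<-mono-≤ M occupiedLevels≤profile)
    0≤9ε : 0ℚ ≤ ι 9 * ε
    0≤9ε = subst (_≤ ι 9 * ε) (*-zeroʳ (ι 9)) (*-monoˡ-≤-nonNeg (ι 9) 0≤ε)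

open import Data.Integer using (+_; -[1+_])
open import Data.Rational using (0ℚ; mkℚ; *<*; _<_; _≤_; _*_; _/_)
open import Data.Fin using (Fin)
open import Data.List using (List)
open import Data.List.Relation.Unary.All using (All)
import Data.Nat

lemma5p9 : {n : ℕ} (Q : Queue n) (T : ℕ) (ε : ℚ) → 0ℚ < ε → ε < + 1 / 3 →
    (pings : List (Fin n × ℕ)) →
    All (λ p → proj₂ p Data.Nat.≤ T × Present Q (proj₁ p) (proj₂ p)) pings →
    AreaDiff (pingRegion Q ε pings) (heightDiagram Q T)
      ≤ ι 9 * ε * Area (heightDiagram Q T)
lemma5p9 Q T ε@(mkℚ (+ p) d coprime) _ ε<⅓ =
  PingArea.pingArea-bound Q T d p ε (Embedding.mkℚ≡ι*invSuc p d coprime) (Arithmetic.3*ε≤1 ε<⅓)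
lemma5p9 Q T (mkℚ -[1+ _ ] _ _) (*<* ())
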